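{- Let $n\geq 0$ and $q\geq 2$ be integers, and let $H$, $\Omega$, $L_\omega$, $Q$, the map $\mu\mapsto\omega(\mu)$ and the matrices $K_\mu$ be as in the context. Then for each $\omega\in\Omega$, $$L_\omega=\sum_{\mu\in Q,\ \omega(\mu)=\omega}K_\mu .$$
   Context: $[q]=\{1,\ldots,q\}$. For $k\geq0$, $\mathcal{C}_k$ is the collection of subsets of $[q]^n$ of cardinality at most $k$. The group $H=S_q^n\rtimes S_n$ acts on $[q]^n$ ($S_q^n$ permuting the letters independently in each coordinate, $S_n$ permuting coordinates), hence on $\mathcal{C}_4$ and on $([q]^n)^4$. $\Omega$ is the set of $H$-orbits on $\mathcal{C}_4$. For $\omega\in\Omega$, $L_\omega$ is the $([q]^n\times[q]^n)\times([q]^n\times[q]^n)$ matrix with $(L_\omega)_{(\alpha,\beta),(\gamma,\delta)}=1$ if $\{\alpha,\beta,\gamma,\delta\}\in\omega$ and $0$ otherwise. $\Pi$ is the set of partitions of $\{1,2,3,4\}$ into at most $q$ classes. For $w\in[q]^4$, $\mathrm{part}(w)\in\Pi$ is the partition in which $i,j$ are in the same class iff $w_i=w_j$. For $P\in\Pi$ let $d_P:=\sum_{i_1,\ldots,i_4\in[q],\ \mathrm{part}(i_1i_2i_3i_4)=P}e_{i_1}e_{i_2}^{\mathsf T}\otimes e_{i_3}e_{i_4}^{\mathsf T}\in\mathbb{R}^{q\times q}\otimes\mathbb{R}^{q\times q}$ ($e_i$ unit vectors of $\mathbb{R}^q$). The set $D=\{d_P:P\in\Pi\}$ is a basis of $W:=(\mathbb{R}^{q\times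 q}\otimes\mathbb{R}^{q\times q})^{S_q}$ ($S_q$ acting diagonally by simultaneous row/column permutation); $\{d_P^*\}$ is the dual basis of $W^*$. $Q$ is the set of degree-$n$ monomials $d^*_{P_1}\cdots d^*_{P_n}$ ($P_j\in\Pi$) in the commuting variables $d^*_P$. For $(\alpha,\beta,\gamma,\delta)\in([q]^n)^4$ put $\psi(\alpha,\beta,\gamma,\delta)=\prod_{i=1}^n d^*_{\mathrm{part}(\alpha_i\beta_i\gamma_i\delta_i)}\in Q$; two quadruples have the same $\psi$ iff they lie in the same $H$-orbit of $([q]^n)^4$. For $\mu\in Q$, $\omega(\mu)\in\Omega$ is the $H$-orbit of $\{\alpha,\beta,\gamma,\delta\}$ for any quadruple with $\psi(\alpha,\beta,\gamma,\delta)=\mu$. For $\mu\in Q$, $K_\mu:=\sum\bigotimes_{j=1}^n d_{P_j}$, summed over all $(P_1,\ldots,P_n)\in\Pi^n$ with $d^*_{P_1}\cdots d^*_{P_n}=\mu$. It is regarded as the $([q]^n)^2\times([q]^n)^2$ matrix whose $((\alpha,\beta),(\gamma,\delta))$-entry is $\sum\prod_{j=1}^n(d_{P_j})_{\alpha_j,\beta_j,\gamma_j,\delta_j}$ (same summation), where $(d_P)_{a,b,c,e}$ is the coefficient of $e_ae_b^{\mathsf T}\otimes e_ce_e^{\mathsf T}$ in $d_P$. -}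

module Defs where

open import Data.Nat using (ℕ; zero; suc; _≤ᵇ_; _≡ᵇ_)
open import Data.Fin using (Fin; toℕ; #_) renaming (_≟_ to _≟ᶠ_)
open import Data.Fin.Permutation using (Permutation′; _⟨$⟩ʳ_)
open import Data.Vec using (Vec; []; _∷_; lookup; tabulate; toList)
import Data.Vec.Properties as VecP
import Data.List.Properties as ListP
open import Data.List using (List; []; _∷_; map; concatMap; filterᵇ; length; upTo; allFin)
open import Data.Bool.ListAction using (and)
open import Data.Nat.ListAction using (sum; product)
open import Data.List.Membership.Propositional using (_∈_)
open import Data.Bool using (Bool; true; false; _∧_; if_then_else_)
open import Data.Product using (Σ; ∃; _×_)
open import Relation.Nullary using (Dec; does)
open import Relation.Binary.PropositionalEquality using (_≡_)

-- Words: [q]^n is Vec (Fin q) n  (letters 0..q-1 instead of 1..q)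

Word : ℕ → ℕ → Set
Word q n = Vec (Fin q) n

allVecs : ∀ {A : Set} → List A → (k : ℕ) → List (Vec A k)
allVecs xs zero    = [] ∷ []
allVecs xs (suc k) = concatMap (λ x → map (x ∷_) (allVecs xs k)) xs

eqFᵇ : ∀ {m} → Fin m → Fin m → Bool
eqFᵇ x y = does (x ≟ᶠ y)

-- Set partitions of {1,2,3,4} (positions 0..3), encoded canonically:
-- a partition P is the vector p with p_i = least element of the class of i.

Code : Set
Code = Vec (Fin 4) 4

codeEqᵇ : Code → Code → Bool
codeEqᵇ p p' = does (VecP.≡-dec _≟ᶠ_ p p')

-- number of classes = number of i that are the least element of their class
numClasses : Code → ℕ
numClasses p = length (filterᵇ (λ i → eqFᵇ (lookup p i) i) (allFin 4))

-- p is the canonical code of a partition into at most q classes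
isPartᵇ : ℕ → Code → Bool
isPartᵇ q p =
  and (map (λ i → (toℕ (lookup p i) ≤ᵇ toℕ i) ∧ eqFᵇ (lookup p (lookup p i)) (lookup p i)) (allFin 4))
  ∧ (numClasses p ≤ᵇ q)

PiList : ℕ → List Code
PiList q = filterᵇ (isPartᵇ q) (allVecs (allFin 4) 4)

firstIdx : ∀ {q} → Vec (Fin q) 4 → Fin 4 → Fin 4
firstIdx w i =
  if eqFᵇ (lookup w (# 0)) (lookup w i) then # 0 else
  if eqFᵇ (lookup w (# 1)) (lookup w i) then # 1 else
  if eqFᵇ (lookup w (# 2)) (lookup w i) then # 2 else # 3

part : ∀ {q} → Vec (Fin q) 4 → Code
part w = tabulate (firstIdx w)

-- (d_P)_{a,b,c,e} : coefficient of e_a e_b^T ⊗ e_c e_e^T in d_P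
dEntry : ∀ {q} → Code → Fin q → Fin q → Fin q → Fin q → ℕ
dEntry P a b c e = if codeEqᵇ (part (a ∷ b ∷ c ∷ e ∷ [])) P then 1 else 0

-- Monomials in the commuting variables d*_P (P ∈ Π), as exponent
-- vectors indexed by the enumeration PiList q.

Monomial : Set
Monomial = List ℕ

monoEqᵇ : Monomial → Monomial → Bool
monoEqᵇ μ ν = does (ListP.≡-dec Data.Nat._≟_ μ ν)
  where import Data.Nat

countCode : ∀ {n} → Code → Vec Code n → ℕ
countCode c Ps = length (filterᵇ (codeEqᵇ c) (toList Ps))

mono : ℕ → ∀ {n} → Vec Code n → Monomial
mono q Ps = map (λ c → countCode c Ps) (PiList q)

QList : ℕ → ℕ → List Monomial
QList q n = filterᵇ (λ e → sum e ≡ᵇ n)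
                    (map toList (allVecs (upTo (suc n)) (length (PiList q))))

psi : ∀ {q n} → Word q n → Word q n → Word q n → Word q n → Monomial
psi {q} {n} α β γ δ =
  mono q (tabulate (λ i → part (lookup α i ∷ lookup β i ∷ lookup γ i ∷ lookup δ i ∷ [])))

-- entry ((α,β),(γ,δ)) of K_μ
KEntry : ∀ {q n} → Monomial → Word q n → Word q n → Word q n → Word q n → ℕ
KEntry {q} {n} μ α β γ δ =
  sum (map (λ Ps → if monoEqᵇ (mono q Ps) μ
                   then product (toList (tabulate (λ j →
                          dEntry (lookup Ps j) (lookup α j) (lookup β j) (lookup γ j) (lookup δ j))))
                   else 0)
           (allVecs (PiList q) n))

-- The group H = S_q^n ⋊ S_n acting on [q]^n:
-- (h·α)_j = σ_j (α_{π j}); these maps are exactly the elements of H.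

H : ℕ → ℕ → Set
H q n = Permutation′ n × (Fin n → Permutation′ q)

act : ∀ {q n} → H q n → Word q n → Word q n
act (π Data.Product., σ) α = tabulate (λ j → σ j ⟨$⟩ʳ lookup α (π ⟨$⟩ʳ j))

-- Finite subsets of [q]^n are represented by lists (as sets: duplicates
-- and order irrelevant). A and B lie in the same H-orbit iff h(A) = B
-- as sets for some h ∈ H.
SameOrbit : ∀ {q n} → List (Word q n) → List (Word q n) → Set
SameOrbit {q} {n} A B =
  Σ (H q n) λ h →
    ((a : Word q n) → a ∈ A → act h a ∈ B) ×
    ((b : Word q n) → b ∈ B → ∃ λ a → a ∈ A × act h a ≡ b)

-- ω(μ) = ω, where ω is the H-orbit of the set S
OmegaOfIs : ∀ {q n} → Monomial → List (Word q n) → Set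
OmegaOfIs {q} {n} μ S =
  Σ (Word q n) λ α → Σ (Word q n) λ β → Σ (Word q n) λ γ → Σ (Word q n) λ δ →
    (psi α β γ δ ≡ μ) × SameOrbit (α ∷ β ∷ γ ∷ δ ∷ []) S

-- entry ((α,β),(γ,δ)) of L_ω, ω = orbit of S
LEntry : ∀ {q n} (S : List (Word q n)) →
         ((A : List (Word q n)) → Dec (SameOrbit A S)) →
         Word q n → Word q n → Word q n → Word q n → ℕ
LEntry S dec α β γ δ = if does (dec (α ∷ β ∷ γ ∷ δ ∷ [])) then 1 else 0

SumKEntry : ∀ {q n} (S : List (Word q n)) →
            ((μ : Monomial) → Dec (OmegaOfIs μ S)) →
            Word q n → Word q n → Word q n → Word q n → ℕ
SumKEntry {q} {n} S dec α β γ δ =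
  sum (map (λ μ → if does (dec μ) then KEntry μ α β γ δ else 0) (QList q n))

module Submission where

-- Let P⁰ = (part(α_j β_j γ_j δ_j))_j be its column partitions, so that
-- ψ(α,β,γ,δ) = d*_{P⁰_1} ⋯ d*_{P⁰_n}.
--  (1) The entry of d_{P_1} ⊗ ⋯ ⊗ d_{P_n} is [P = P⁰], and P⁰ occurs once in Πⁿ,
--      so the entry of K_μ is [ψ(α,β,γ,δ) = μ] (KEntry-delta).
--  (2) ψ(α,β,γ,δ) has degree n and occurs once in Q, so the entry of
--      Σ_{ω(μ)=ω} K_μ is [ω(ψ(α,β,γ,δ)) = ω] (SumKEntry-indicator).
--  (3) Equal ψ forces the column partitions to be permuted copies of each other
--      and equal column partitions are related by letter permutations, so
--      quadruples with equal ψ are H-related; as orbits are H-invariant,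
--      ω(ψ(α,β,γ,δ)) = ω iff {α,β,γ,δ} ∈ ω (SameOrbit⇔OmegaOfIs-psi).

open import Defs
open import Data.Nat using (ℕ; zero; suc; _+_; _*_; _≤_; _≤?_; _≤ᵇ_; _≡ᵇ_; z≤n; s≤s)
import Data.Nat as ℕ
open import Data.Nat.Properties
  using (+-identityʳ; +-assoc; +-cancelˡ-≡; *-zeroʳ; *-distribˡ-+; *-distribʳ-+;
         ≤-trans; ≤-reflexive; m≤m+n; ≤⇒≤ᵇ; ≡⇒≡ᵇ; +-commutativeSemigroup)
open import Data.Nat.ListAction using (sum; product)
open import Algebra.Properties.CommutativeSemigroup +-commutativeSemigroup
  using (x∙yz≈y∙xz) renaming (interchange to +-interchange)
open import Data.Bool using (Bool; true; false; if_then_else_; T; T?; _∧_)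
open import Data.Bool.Properties using (T-≡; if-eta)
open import Data.Fin using (Fin; zero; suc; toℕ; punchOut; #_) renaming (_≟_ to _≟ᶠ_)
open import Data.Fin.Properties using (all?; any?)
open import Data.Fin.Permutation using (Permutation′; _⟨$⟩ʳ_; _⟨$⟩ˡ_; _∘ₚ_; insert; inverseˡ)
import Data.Fin.Permutation as Perm
import Data.Fin.Permutation.Components as PermC
open import Data.Vec using (Vec; []; _∷_; lookup; tabulate; toList; fromList; removeAt)
import Data.Vec as Vec
import Data.Vec.Properties as VecP
open import Data.Vec.Membership.Propositional.Properties using (∈-toList⁻)
import Data.Vec.Relation.Unary.All.Properties as VecAll
open import Data.Vec.Relation.Unary.Any using (index)
open import Data.List.Membership.DecPropositional (VecP.≡-dec {n = 4} (_≟ᶠ_ {4})) using () renaming (_∈?_ to _∈Π?_)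
open import Data.Vec.Relation.Unary.Any.Properties using (lookup-index)
open import Data.List using (List; []; _∷_; map; concatMap; filterᵇ; length; _++_; upTo; allFin)
import Data.List.Properties as ListP
open import Data.List.Relation.Unary.All using (All; []; _∷_)
import Data.List.Relation.Unary.All as All
open import Data.List.Relation.Unary.All.Properties using (All¬⇒¬Any)
open import Data.List.Relation.Unary.Any using (here; there)
open import Data.List.Membership.Propositional using (_∈_; _∉_)
open import Data.List.Membership.Propositional.Properties using (∈-map⁺; ∈-map⁻; ∈-upTo⁺; ∈-allFin)
open import Data.List.Relation.Unary.Unique.Propositional using (Unique; []; _∷_)
open import Data.List.Relation.Unary.Unique.Propositional.Properties using (upTo⁺; allFin⁺)
open import Data.Product using (Σ; ∃; _×_; _,_; proj₁; proj₂)
open import Data.Empty using (⊥-elim)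
open import Function using (_∘_)
open import Function.Bundles using (Equivalence; _⇔_; mk⇔)
open import Relation.Nullary using (Dec; yes; no; does)
open import Relation.Nullary.Decidable using (dec-true; dec-false; from-yes; does-⇔)
open import Relation.Binary.Definitions using (DecidableEquality)
open import Relation.Binary.PropositionalEquality

sum-map-+ : ∀ {A : Set} (f g : A → ℕ) xs → sum (map (λ c → f c + g c) xs) ≡ sum (map f xs) + sum (map g xs)
sum-map-+ f g []       = refl
sum-map-+ f g (c ∷ xs) = trans (cong (f c + g c +_) (sum-map-+ f g xs)) (+-interchange (f c) (g c) _ _)

module Multiplicity {A : Set} (_≟_ : DecidableEquality A) where

  kron : A → A → ℕ
  kron x y = if does (x ≟ y) then 1 else 0

  mult : A → List A → ℕ
  mult x []       = 0
  mult x (y ∷ ys) = kron x y + mult x ys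

  kron-refl : ∀ x → kron x x ≡ 1
  kron-refl x rewrite dec-true (x ≟ x) refl = refl

  kron-≢ : ∀ {x y} → x ≢ y → kron x y ≡ 0
  kron-≢ {x} {y} x≢y rewrite dec-false (x ≟ y) x≢y = refl

  kron-sym : ∀ x y → kron x y ≡ kron y x
  kron-sym x y with x ≟ y
  ... | yes refl = sym (kron-refl x)
  ... | no x≢y   = sym (kron-≢ (x≢y ∘ sym))

  length-filter≡mult : ∀ x ys → length (filterᵇ (λ y → does (x ≟ y)) ys) ≡ mult x ys
  length-filter≡mult x []       = refl
  length-filter≡mult x (y ∷ ys) with x ≟ y
  ... | yes _ = cong suc (length-filter≡mult x ys)
  ... | no _  = length-filter≡mult x ys

  sum-supported : ∀ x (f : A → ℕ) → (∀ y → x ≢ y → f y ≡ 0) →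
                  ∀ ys → sum (map f ys) ≡ mult x ys * f x
  sum-supported x f f0 []       = refl
  sum-supported x f f0 (y ∷ ys) with x ≟ y
  ... | yes refl = cong (f x +_) (sum-supported x f f0 ys)
  ... | no x≢y   = trans (cong (_+ sum (map f ys)) (f0 y x≢y)) (sum-supported x f f0 ys)

  mult-filter : ∀ x (p : A → Bool) → p x ≡ true → ∀ ys → mult x (filterᵇ p ys) ≡ mult x ys
  mult-filter x p px []       = refl
  mult-filter x p px (y ∷ ys) with p y in py
  ... | true  = cong (kron x y +_) (mult-filter x p px ys)
  ... | false = trans (mult-filter x p px ys) (cong (_+ mult x ys) (sym (kron-≢ x≢y)))
    where
    x≢y : x ≢ y
    x≢y refl with () ← trans (sym px) py

  mult-∉ : ∀ {x ys} → x ∉ ys → mult x ys ≡ 0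
  mult-∉ {ys = []}     _   = refl
  mult-∉ {ys = y ∷ ys} x∉ = cong₂ _+_ (kron-≢ (x∉ ∘ here)) (mult-∉ (x∉ ∘ there))

  mult-suc⇒∈ : ∀ x ys {k} → mult x ys ≡ suc k → x ∈ ys
  mult-suc⇒∈ x []       ()
  mult-suc⇒∈ x (y ∷ ys) m with x ≟ y
  ... | yes x≡y = here x≡y
  ... | no _    = there (mult-suc⇒∈ x ys m)

  mult-unique : ∀ {x ys} → Unique ys → x ∈ ys → mult x ys ≡ 1
  mult-unique {x} (y≢ys ∷ _) (here refl) =
    cong₂ _+_ (kron-refl x) (mult-∉ (All¬⇒¬Any y≢ys))
  mult-unique (y≢ys ∷ u) (there x∈ys) =
    cong₂ _+_ (kron-≢ (λ { refl → All.lookup y≢ys x∈ys refl })) (mult-unique u x∈ys)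

  mult-++ : ∀ x xs ys → mult x (xs ++ ys) ≡ mult x xs + mult x ys
  mult-++ x []       ys = refl
  mult-++ x (z ∷ zs) ys = trans (cong (kron x z +_) (mult-++ x zs ys)) (sym (+-assoc (kron x z) _ _))

  double-counting : ∀ L l → sum (map (λ c → mult c l) L) ≡ sum (map (λ x → mult x L) l)
  double-counting L []      = zeros L
    where
    zeros : ∀ L → sum (map (λ _ → 0) L) ≡ 0
    zeros []      = refl
    zeros (_ ∷ L) = zeros L
  double-counting L (x ∷ l) = begin
    sum (map (λ c → kron c x + mult c l) L)              ≡⟨ sum-map-+ (λ c → kron c x) (λ c → mult c l) L ⟩
    sum (map (λ c → kron c x) L) + sum (map (λ c → mult c l) L)
                                                         ≡⟨ cong₂ _+_ (kron-column L) (double-counting L l) ⟩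
    mult x L + sum (map (λ y → mult y L) l)              ∎
    where
    open ≡-Reasoning
    kron-column : ∀ L → sum (map (λ c → kron c x) L) ≡ mult x L
    kron-column []      = refl
    kron-column (c ∷ L) = cong₂ _+_ (kron-sym c x) (kron-column L)

  sum-mult≡length : ∀ L l → All (λ x → mult x L ≡ 1) l → sum (map (λ c → mult c l) L) ≡ length l
  sum-mult≡length L l once = trans (double-counting L l) (ones l once)
    where
    ones : ∀ l → All (λ x → mult x L ≡ 1) l → sum (map (λ x → mult x L) l) ≡ length l
    ones []      []             = refl
    ones (x ∷ l) (x-once ∷ rest) = cong₂ _+_ x-once (ones l rest)

  mult-removeAt : ∀ {m} c (v : Vec A (suc m)) k →
                  mult c (toList v) ≡ kron c (lookup v k) + mult c (toList (removeAt v k))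
  mult-removeAt c (y ∷ v)     zero    = refl
  mult-removeAt c (y ∷ z ∷ v) (suc k) =
    trans (cong (kron c y +_) (mult-removeAt c (z ∷ v) k))
          (x∙yz≈y∙xz (kron c y) (kron c (lookup (z ∷ v) k)) (mult c (toList (removeAt (z ∷ v) k))))

  same-multiplicities⇒permutation :
    ∀ {m} (u v : Vec A m) → (∀ c → mult c (toList u) ≡ mult c (toList v)) →
    Σ (Permutation′ m) λ π → ∀ j → lookup v j ≡ lookup u (π ⟨$⟩ʳ j)
  same-multiplicities⇒permutation []      []  _        = Perm.id , λ ()
  same-multiplicities⇒permutation (x ∷ u) v   same-mult = π , v≡u∘π
    where
    x∈v : x ∈ toList v
    x∈v = mult-suc⇒∈ x (toList v) (trans (sym (same-mult x)) (cong (_+ mult x (toList u)) (kron-refl x)))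
    x∈v′ = ∈-toList⁻ x∈v
    k = index x∈v′
    vₖ≡x : lookup v k ≡ x
    vₖ≡x = sym (lookup-index x∈v′)
    v′ = removeAt v k
    rest = same-multiplicities⇒permutation u v′ λ c → +-cancelˡ-≡ (kron c x) _ _ (begin
      kron c x + mult c (toList u)             ≡⟨ same-mult c ⟩
      mult c (toList v)                        ≡⟨ mult-removeAt c v k ⟩
      kron c (lookup v k) + mult c (toList v′) ≡⟨ cong (λ z → kron c z + mult c (toList v′)) vₖ≡x ⟩
      kron c x + mult c (toList v′)            ∎)
      where open ≡-Reasoning
    π = insert k zero (proj₁ rest)
    v≡u∘π : ∀ j → lookup v j ≡ lookup (x ∷ u) (π ⟨$⟩ʳ j)
    v≡u∘π j with k ≟ᶠ j
    ... | yes refl = vₖ≡x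
    ... | no k≢j   = trans (sym (VecP.removeAt-punchOut v k≢j)) (proj₂ rest (punchOut k≢j))

module VecMultiplicity {A : Set} (_≟_ : DecidableEquality A) where
  open Multiplicity _≟_ public
  module V {k : ℕ} = Multiplicity (VecP.≡-dec {n = k} _≟_)

  kron-∷ : ∀ {k} x y (u v : Vec A k) → V.kron (x ∷ u) (y ∷ v) ≡ kron x y * V.kron u v
  kron-∷ x y u v with x ≟ y | VecP.≡-dec _≟_ u v
  ... | yes refl | yes refl = refl
  ... | yes refl | no _     = refl
  ... | no _     | _        = refl

  -- Vectors are equal iff they agree coordinatewise: the delta factorises.
  product-kron : ∀ {k} (g : Fin k → A) (v : Vec A k) →
                 product (toList (tabulate (λ j → kron (g j) (lookup v j)))) ≡ V.kron (tabulate g) v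
  product-kron g []      = sym (V.kron-refl [])
  product-kron g (y ∷ v) =
    trans (cong (kron (g zero) y *_) (product-kron (g ∘ suc) v)) (sym (kron-∷ (g zero) y (tabulate (g ∘ suc)) v))

  mult-prefixed : ∀ {k} x (u : Vec A k) ys Vs →
                  V.mult (x ∷ u) (concatMap (λ y → map (y ∷_) Vs) ys) ≡ mult x ys * V.mult u Vs
  mult-prefixed x u []       Vs = refl
  mult-prefixed x u (y ∷ ys) Vs = begin
    V.mult (x ∷ u) (map (y ∷_) Vs ++ rest)
      ≡⟨ V.mult-++ (x ∷ u) (map (y ∷_) Vs) rest ⟩
    V.mult (x ∷ u) (map (y ∷_) Vs) + V.mult (x ∷ u) rest
      ≡⟨ cong₂ _+_ (one-prefix Vs) (mult-prefixed x u ys Vs) ⟩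
    kron x y * V.mult u Vs + mult x ys * V.mult u Vs
      ≡⟨ sym (*-distribʳ-+ (V.mult u Vs) (kron x y) (mult x ys)) ⟩
    (kron x y + mult x ys) * V.mult u Vs ∎
    where
    open ≡-Reasoning
    rest = concatMap (λ y → map (y ∷_) Vs) ys
    one-prefix : ∀ Ws → V.mult (x ∷ u) (map (y ∷_) Ws) ≡ kron x y * V.mult u Ws
    one-prefix []       = sym (*-zeroʳ (kron x y))
    one-prefix (w ∷ Ws) = trans (cong₂ _+_ (kron-∷ x y u w) (one-prefix Ws))
                                (sym (*-distribˡ-+ (kron x y) (V.kron u w) (V.mult u Ws)))

  mult-allVecs : ∀ xs k (v : Vec A k) → (∀ i → mult (lookup v i) xs ≡ 1) → V.mult v (allVecs xs k) ≡ 1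
  mult-allVecs xs zero    []      _    = cong (_+ 0) (V.kron-refl [])
  mult-allVecs xs (suc k) (x ∷ v) once = begin
    V.mult (x ∷ v) (allVecs xs (suc k))   ≡⟨ mult-prefixed x v xs (allVecs xs k) ⟩
    mult x xs * V.mult v (allVecs xs k)   ≡⟨ cong₂ _*_ (once zero) (mult-allVecs xs k v (once ∘ suc)) ⟩
    1                                     ∎
    where open ≡-Reasoning

  module L = Multiplicity (ListP.≡-dec _≟_)

  mult-toList : ∀ {k} (u : Vec A k) Vs → L.mult (toList u) (map toList Vs) ≡ V.mult u Vs
  mult-toList u []       = refl
  mult-toList u (w ∷ Vs) = cong₂ _+_ kron-toList (mult-toList u Vs)
    where
    kron-toList : L.kron (toList u) (toList w) ≡ V.kron u w
    kron-toList with VecP.≡-dec _≟_ u w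
    ... | yes refl = L.kron-refl (toList u)
    ... | no u≢w   = L.kron-≢ λ e → u≢w (trans (sym (VecP.cast-is-id refl u)) (VecP.toList-injective refl u w e))

module FinMult = VecMultiplicity (_≟ᶠ_ {4})
module CodeMult = VecMultiplicity (VecP.≡-dec {n = 4} (_≟ᶠ_ {4}))

T⇒≡true : ∀ {b} → T b → b ≡ true
T⇒≡true = Equivalence.to T-≡

-- The position of the first occurrence of a letter in a word of length 4;
-- by definition  firstIdx w i = firstOccurrence w (lookup w i).
firstOccurrence : ∀ {q} → Vec (Fin q) 4 → Fin q → Fin 4
firstOccurrence w v =
  if eqFᵇ (lookup w (# 0)) v then # 0 else
  if eqFᵇ (lookup w (# 1)) v then # 1 else
  if eqFᵇ (lookup w (# 2)) v then # 2 else # 3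

firstIdx-spec : ∀ {q} (w : Vec (Fin q) 4) i →
                lookup w (firstIdx w i) ≡ lookup w i × toℕ (firstIdx w i) ≤ toℕ i
firstIdx-spec w@(a ∷ b ∷ c ∷ d ∷ []) i with a ≟ᶠ lookup w i
... | yes a≡wᵢ = a≡wᵢ , z≤n
... | no a≢wᵢ with b ≟ᶠ lookup w i
...   | yes b≡wᵢ = b≡wᵢ , i≥1 i a≢wᵢ
  where
  i≥1 : ∀ i → a ≢ lookup w i → 1 ≤ toℕ i
  i≥1 zero    a≢ = ⊥-elim (a≢ refl)
  i≥1 (suc _) _  = s≤s z≤n
...   | no b≢wᵢ with c ≟ᶠ lookup w i
...     | yes c≡wᵢ = c≡wᵢ , i≥2 i a≢wᵢ b≢wᵢ
  where
  i≥2 : ∀ i → a ≢ lookup w i → b ≢ lookup w i → 2 ≤ toℕ i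
  i≥2 zero          a≢ _  = ⊥-elim (a≢ refl)
  i≥2 (suc zero)    _  b≢ = ⊥-elim (b≢ refl)
  i≥2 (suc (suc _)) _  _  = s≤s (s≤s z≤n)
...     | no c≢wᵢ = last i a≢wᵢ b≢wᵢ c≢wᵢ
  where
  last : ∀ i → a ≢ lookup w i → b ≢ lookup w i → c ≢ lookup w i → d ≡ lookup w i × 3 ≤ toℕ i
  last zero                   a≢ _  _  = ⊥-elim (a≢ refl)
  last (suc zero)             _  b≢ _  = ⊥-elim (b≢ refl)
  last (suc (suc zero))       _  _  c≢ = ⊥-elim (c≢ refl)
  last (suc (suc (suc zero))) _  _  _  = refl , s≤s (s≤s (s≤s z≤n))

firstIdx-idem : ∀ {q} (w : Vec (Fin q) 4) i → firstIdx w (firstIdx w i) ≡ firstIdx w i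
firstIdx-idem w i = cong (firstOccurrence w) (proj₁ (firstIdx-spec w i))

part-canonical-at : ∀ {q} (w : Vec (Fin q) 4) i →
  ((toℕ (lookup (part w) i) ≤ᵇ toℕ i) ∧ eqFᵇ (lookup (part w) (lookup (part w) i)) (lookup (part w) i)) ≡ true
part-canonical-at w i
  rewrite VecP.lookup∘tabulate (firstIdx w) i
        | VecP.lookup∘tabulate (firstIdx w) (firstIdx w i)
        | firstIdx-idem w i
        | T⇒≡true (≤⇒≤ᵇ (proj₂ (firstIdx-spec w i)))
        = dec-true (firstIdx w i ≟ᶠ firstIdx w i) refl

-- A word over q letters has at most q letter classes: for q ≤ 3 by exhaustive
-- check, for q ≥ 4 because there are only four positions.
FewClasses : ℕ → Set
FewClasses q = ∀ (a b c d : Fin q) → numClasses (part (a ∷ b ∷ c ∷ d ∷ [])) ≤ q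

fewClasses? : ∀ q → Dec (FewClasses q)
fewClasses? q = all? λ a → all? λ b → all? λ c → all? λ d → numClasses (part (a ∷ b ∷ c ∷ d ∷ [])) ≤? q

numClasses≤ : ∀ q (w : Vec (Fin q) 4) → numClasses (part w) ≤ q
numClasses≤ 0 (() ∷ _)
numClasses≤ 1 (a ∷ b ∷ c ∷ d ∷ []) = from-yes (fewClasses? 1) a b c d
numClasses≤ 2 (a ∷ b ∷ c ∷ d ∷ []) = from-yes (fewClasses? 2) a b c d
numClasses≤ 3 (a ∷ b ∷ c ∷ d ∷ []) = from-yes (fewClasses? 3) a b c d
numClasses≤ (suc (suc (suc (suc q)))) w =
  ≤-trans (ListP.length-filter (λ i → T? (eqFᵇ (lookup (part w) i) i)) (allFin 4)) (m≤m+n 4 q)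

part∈Π : ∀ q (w : Vec (Fin q) 4) → isPartᵇ q (part w) ≡ true
part∈Π q w
  rewrite part-canonical-at w zero | part-canonical-at w (suc zero)
        | part-canonical-at w (suc (suc zero)) | part-canonical-at w (suc (suc (suc zero)))
        = T⇒≡true (≤⇒≤ᵇ (numClasses≤ q w))

part-once : ∀ q (w : Vec (Fin q) 4) → CodeMult.mult (part w) (PiList q) ≡ 1
part-once q w = trans (CodeMult.mult-filter (part w) (isPartᵇ q) (part∈Π q w) (allVecs (allFin 4) 4))
  (FinMult.mult-allVecs (allFin 4) 4 (part w) λ i → FinMult.mult-unique (allFin⁺ 4) (∈-allFin (lookup (part w) i)))

same-part⇒same-pattern : ∀ {q} (x y : Vec (Fin q) 4) → part x ≡ part y →
                         ∀ i k → lookup x i ≡ lookup x k → lookup y i ≡ lookup y k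
same-part⇒same-pattern x y x~y i k xᵢ≡xₖ = begin
  lookup y i                ≡⟨ sym (proj₁ (firstIdx-spec y i)) ⟩
  lookup y (firstIdx y i)   ≡⟨ cong (lookup y) (sym (same-first i)) ⟩
  lookup y (firstIdx x i)   ≡⟨ cong (lookup y ∘ firstOccurrence x) xᵢ≡xₖ ⟩
  lookup y (firstIdx x k)   ≡⟨ cong (lookup y) (same-first k) ⟩
  lookup y (firstIdx y k)   ≡⟨ proj₁ (firstIdx-spec y k) ⟩
  lookup y k                ∎
  where
  open ≡-Reasoning
  same-first : ∀ i → firstIdx x i ≡ firstIdx y i
  same-first i = begin
    firstIdx x i           ≡⟨ sym (VecP.lookup∘tabulate (firstIdx x) i) ⟩
    lookup (part x) i      ≡⟨ cong (λ p → lookup p i) x~y ⟩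
    lookup (part y) i      ≡⟨ VecP.lookup∘tabulate (firstIdx y) i ⟩
    firstIdx y i           ∎

module NatMult = VecMultiplicity ℕ._≟_

column : ∀ {q n} → (α β γ δ : Word q n) → Fin n → Vec (Fin q) 4
column α β γ δ j = lookup α j ∷ lookup β j ∷ lookup γ j ∷ lookup δ j ∷ []

columnParts : ∀ {q n} → (α β γ δ : Word q n) → Vec Code n
columnParts α β γ δ = tabulate (part ∘ column α β γ δ)

columnParts-once : ∀ {q n} (α β γ δ : Word q n) j →
                   CodeMult.mult (lookup (columnParts α β γ δ) j) (PiList q) ≡ 1
columnParts-once {q} α β γ δ j =
  subst (λ c → CodeMult.mult c (PiList q) ≡ 1)
        (sym (VecP.lookup∘tabulate (part ∘ column α β γ δ) j)) (part-once q (column α β γ δ j))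

-- (1) The (α,β,γ,δ)-entry of K_μ is [ψ(α,β,γ,δ) = μ]: only the summand
-- P = P⁰ contributes, and it occurs once among the tuples in Πⁿ.
KEntry-delta : ∀ {q n} (μ : Monomial) (α β γ δ : Word q n) →
               KEntry μ α β γ δ ≡ NatMult.L.kron (psi α β γ δ) μ
KEntry-delta {q} {n} μ α β γ δ = begin
  KEntry μ α β γ δ                                   ≡⟨ CodeMult.V.sum-supported P⁰ summand vanishes (allVecs (PiList q) n) ⟩
  CodeMult.V.mult P⁰ (allVecs (PiList q) n) * summand P⁰
                                                     ≡⟨ cong (_* summand P⁰) P⁰-once ⟩
  summand P⁰ + 0                                     ≡⟨ +-identityʳ (summand P⁰) ⟩
  summand P⁰                                         ≡⟨ at-P⁰ ⟩
  NatMult.L.kron (psi α β γ δ) μ                     ∎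
  where
  open ≡-Reasoning
  P⁰ = columnParts α β γ δ
  P⁰-once : CodeMult.V.mult P⁰ (allVecs (PiList q) n) ≡ 1
  P⁰-once = CodeMult.mult-allVecs (PiList q) n P⁰ (columnParts-once α β γ δ)
  product-entry : ∀ Ps → product (toList (tabulate (λ j →
                    dEntry (lookup Ps j) (lookup α j) (lookup β j) (lookup γ j) (lookup δ j))))
                  ≡ CodeMult.V.kron P⁰ Ps
  product-entry = CodeMult.product-kron (part ∘ column α β γ δ)
  summand : Vec Code n → ℕ
  summand Ps = if monoEqᵇ (mono q Ps) μ
               then product (toList (tabulate (λ j →
                      dEntry (lookup Ps j) (lookup α j) (lookup β j) (lookup γ j) (lookup δ j))))
               else 0
  vanishes : ∀ Ps → P⁰ ≢ Ps → summand Ps ≡ 0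
  vanishes Ps P⁰≢Ps rewrite product-entry Ps | CodeMult.V.kron-≢ P⁰≢Ps = if-eta (monoEqᵇ (mono q Ps) μ)
  at-P⁰ : summand P⁰ ≡ NatMult.L.kron (psi α β γ δ) μ
  at-P⁰ rewrite product-entry P⁰ | CodeMult.V.kron-refl P⁰ = refl

psi-degree : ∀ {q n} (α β γ δ : Word q n) → sum (psi α β γ δ) ≡ n
psi-degree {q} {n} α β γ δ = begin
  sum (map (λ c → countCode c P⁰) (PiList q))
    ≡⟨ cong sum (ListP.map-cong (λ c → CodeMult.length-filter≡mult c (toList P⁰)) (PiList q)) ⟩
  sum (map (λ c → CodeMult.mult c (toList P⁰)) (PiList q))
    ≡⟨ CodeMult.sum-mult≡length (PiList q) (toList P⁰)
         (VecAll.toList⁺ (VecAll.tabulate⁺ (part-once q ∘ column α β γ δ))) ⟩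
  length (toList P⁰)
    ≡⟨ VecP.length-toList P⁰ ⟩
  n ∎
  where
  open ≡-Reasoning
  P⁰ = columnParts α β γ δ

psi-exponent≤ : ∀ {q n} (α β γ δ : Word q n) c → countCode c (columnParts α β γ δ) ≤ n
psi-exponent≤ α β γ δ c =
  ≤-trans (ListP.length-filter (λ P → T? (codeEqᵇ c P)) (toList P⁰)) (≤-reflexive (VecP.length-toList P⁰))
  where P⁰ = columnParts α β γ δ

psi-once : ∀ {q n} (α β γ δ : Word q n) → NatMult.L.mult (psi α β γ δ) (QList q n) ≡ 1
psi-once {q} {n} α β γ δ = begin
  NatMult.L.mult (psi α β γ δ) (QList q n)
    ≡⟨ NatMult.L.mult-filter (psi α β γ δ) (λ e → sum e ≡ᵇ n)
         (T⇒≡true (≡⇒≡ᵇ _ n (psi-degree α β γ δ))) (map toList candidates) ⟩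
  NatMult.L.mult (psi α β γ δ) (map toList candidates)
    ≡⟨ cong (λ e → NatMult.L.mult e (map toList candidates)) (sym exponents-toList) ⟩
  NatMult.L.mult (toList exponents) (map toList candidates)
    ≡⟨ NatMult.mult-toList exponents candidates ⟩
  NatMult.V.mult exponents candidates
    ≡⟨ NatMult.mult-allVecs (upTo (suc n)) (length (PiList q)) exponents exponent-once ⟩
  1 ∎
  where
  open ≡-Reasoning
  exponent : Code → ℕ
  exponent c = countCode c (columnParts α β γ δ)
  candidates = allVecs (upTo (suc n)) (length (PiList q))
  exponents : Vec ℕ (length (PiList q))
  exponents = Vec.map exponent (fromList (PiList q))
  exponents-toList : toList exponents ≡ psi α β γ δ
  exponents-toList = trans (VecP.toList-map exponent (fromList (PiList q)))
                           (cong (map exponent) (VecP.toList∘fromList (PiList q)))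
  exponent-once : ∀ i → NatMult.mult (lookup exponents i) (upTo (suc n)) ≡ 1
  exponent-once i = subst (λ k → NatMult.mult k (upTo (suc n)) ≡ 1)
    (sym (VecP.lookup-map i exponent (fromList (PiList q))))
    (NatMult.mult-unique (upTo⁺ (suc n)) (∈-upTo⁺ (s≤s (psi-exponent≤ α β γ δ (lookup (fromList (PiList q)) i)))))

SumKEntry-indicator : ∀ {q n} (S : List (Word q n)) (decΩ : (μ : Monomial) → Dec (OmegaOfIs μ S))
  (α β γ δ : Word q n) → SumKEntry S decΩ α β γ δ ≡ (if does (decΩ (psi α β γ δ)) then 1 else 0)
SumKEntry-indicator {q} {n} S decΩ α β γ δ = begin
  SumKEntry S decΩ α β γ δ                          ≡⟨ NatMult.L.sum-supported ψ summand vanishes (QList q n) ⟩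
  NatMult.L.mult ψ (QList q n) * summand ψ          ≡⟨ cong (_* summand ψ) (psi-once α β γ δ) ⟩
  summand ψ + 0                                     ≡⟨ +-identityʳ (summand ψ) ⟩
  summand ψ                                         ≡⟨ cong (λ k → if does (decΩ ψ) then k else 0) at-ψ ⟩
  (if does (decΩ ψ) then 1 else 0)                  ∎
  where
  open ≡-Reasoning
  ψ = psi α β γ δ
  summand : Monomial → ℕ
  summand μ = if does (decΩ μ) then KEntry μ α β γ δ else 0
  vanishes : ∀ μ → ψ ≢ μ → summand μ ≡ 0
  vanishes μ ψ≢μ = trans (cong (λ k → if does (decΩ μ) then k else 0)
                              (trans (KEntry-delta μ α β γ δ) (NatMult.L.kron-≢ ψ≢μ)))
                         (if-eta (does (decΩ μ)))
  at-ψ : KEntry ψ α β γ δ ≡ 1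
  at-ψ = trans (KEntry-delta ψ α β γ δ) (NatMult.L.kron-refl ψ)

compose : ∀ {q n} → H q n → H q n → H q n
compose (π′ , σ′) (π , σ) = (π′ ∘ₚ π) , (λ j → σ (π′ ⟨$⟩ʳ j) ∘ₚ σ′ j)

act-compose : ∀ {q n} (h′ h : H q n) (a : Word q n) → act (compose h′ h) a ≡ act h′ (act h a)
act-compose (π′ , σ′) (π , σ) a = VecP.tabulate-cong λ j →
  cong (σ′ j ⟨$⟩ʳ_) (sym (VecP.lookup∘tabulate (λ k → σ k ⟨$⟩ʳ lookup a (π ⟨$⟩ʳ k)) (π′ ⟨$⟩ʳ j)))

SameOrbit-transport : ∀ {q n} (h : H q n) {A A′ S : List (Word q n)} →
                      map (act h) A ≡ A′ → SameOrbit A′ S → SameOrbit A S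
SameOrbit-transport h {A} {S = S} refl (h′ , into , onto) = compose h′ h , into′ , onto′
  where
  into′ : ∀ a → a ∈ A → act (compose h′ h) a ∈ S
  into′ a a∈A = subst (_∈ S) (sym (act-compose h′ h a)) (into (act h a) (∈-map⁺ (act h) a∈A))
  onto′ : ∀ b → b ∈ S → ∃ λ a → a ∈ A × act (compose h′ h) a ≡ b
  onto′ b b∈S with onto b b∈S
  ... | a′ , a′∈hA , h′a′≡b with ∈-map⁻ (act h) a′∈hA
  ...   | a , a∈A , refl = a , a∈A , trans (act-compose h′ h a) h′a′≡b

same-pattern⇒letter-permutation :
  ∀ {q m} (x y : Vec (Fin q) m) →
  (∀ i k → lookup x i ≡ lookup x k → lookup y i ≡ lookup y k) →
  (∀ i k → lookup y i ≡ lookup y k → lookup x i ≡ lookup x k) →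
  Σ (Permutation′ q) λ σ → ∀ i → σ ⟨$⟩ʳ lookup x i ≡ lookup y i
same-pattern⇒letter-permutation []      []      _     _     = Perm.id , λ ()
same-pattern⇒letter-permutation (a ∷ x) (b ∷ y) x⇒y y⇒x
  with same-pattern⇒letter-permutation x y (λ i k → x⇒y (suc i) (suc k)) (λ i k → y⇒x (suc i) (suc k))
... | σ , σx≡y with any? (λ i → lookup x i ≟ᶠ a)
-- a already occurs in x, at position i, and σ already sends it to b
...   | yes (i , xᵢ≡a) = σ , λ
  { zero    → trans (cong (σ ⟨$⟩ʳ_) (sym xᵢ≡a)) (trans (σx≡y i) (sym (x⇒y zero (suc i) (sym xᵢ≡a))))
  ; (suc k) → σx≡y k }
-- a is new; then b is new in y as well, and swapping σ(a) with b repairs σ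
...   | no a∉x = (σ ∘ₚ Perm.transpose (σ ⟨$⟩ʳ a) b) , λ
  { zero    → transpose-at (σ ⟨$⟩ʳ a) b
  ; (suc k) → trans (cong (PermC.transpose (σ ⟨$⟩ʳ a) b) (σx≡y k))
                    (transpose-fixes (λ yₖ≡σa → a∉x (k , σ-injective (trans (σx≡y k) yₖ≡σa)))
                                     (λ yₖ≡b → a∉x (k , y⇒x (suc k) zero yₖ≡b))) }
  where
  σ-injective : ∀ {u v} → σ ⟨$⟩ʳ u ≡ σ ⟨$⟩ʳ v → u ≡ v
  σ-injective {u} {v} e = trans (sym (inverseˡ σ)) (trans (cong (σ ⟨$⟩ˡ_) e) (inverseˡ σ))
  transpose-at : ∀ i j → PermC.transpose i j i ≡ j
  transpose-at i j rewrite dec-true (i ≟ᶠ i) refl = refl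
  transpose-fixes : ∀ {i j k} → k ≢ i → k ≢ j → PermC.transpose i j k ≡ k
  transpose-fixes {i} {j} {k} k≢i k≢j rewrite dec-false (k ≟ᶠ i) k≢i | dec-false (k ≟ᶠ j) k≢j = refl

map-≡⇒agree : ∀ {A B : Set} (f g : A → B) {xs} → map f xs ≡ map g xs → ∀ {x} → x ∈ xs → f x ≡ g x
map-≡⇒agree f g {_ ∷ _}  fxs≡gxs (here refl)  = ListP.∷-injectiveˡ fxs≡gxs
map-≡⇒agree f g {_ ∷ xs} fxs≡gxs (there x∈xs) = map-≡⇒agree f g (ListP.∷-injectiveʳ fxs≡gxs) x∈xs

same-psi⇒same-column-multiplicities :
  ∀ {q n} (α β γ δ α′ β′ γ′ δ′ : Word q n) → psi α β γ δ ≡ psi α′ β′ γ′ δ′ →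
  ∀ c → CodeMult.mult c (toList (columnParts α β γ δ)) ≡ CodeMult.mult c (toList (columnParts α′ β′ γ′ δ′))
same-psi⇒same-column-multiplicities {q} α β γ δ α′ β′ γ′ δ′ ψ≡ψ′ c with c ∈Π? PiList q
... | yes c∈Π = begin
  CodeMult.mult c (toList P⁰)  ≡⟨ sym (CodeMult.length-filter≡mult c (toList P⁰)) ⟩
  countCode c P⁰               ≡⟨ map-≡⇒agree (λ c → countCode c P⁰) (λ c → countCode c P⁰′) ψ≡ψ′ c∈Π ⟩
  countCode c P⁰′              ≡⟨ CodeMult.length-filter≡mult c (toList P⁰′) ⟩
  CodeMult.mult c (toList P⁰′) ∎
  where
  open ≡-Reasoning
  P⁰ = columnParts α β γ δ
  P⁰′ = columnParts α′ β′ γ′ δ′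
... | no c∉Π = trans (unused α β γ δ) (sym (unused α′ β′ γ′ δ′))
  where
  -- every column partition lies in Π, so c is used by no column
  unused : ∀ (a b c′ d : Word q _) → CodeMult.mult c (toList (columnParts a b c′ d)) ≡ 0
  unused a b c′ d = CodeMult.mult-∉ λ c∈P⁰ →
    let c∈P⁰′ = ∈-toList⁻ {xs = columnParts a b c′ d} c∈P⁰
        j = index c∈P⁰′
    in c∉Π (subst (_∈ PiList q) (sym (lookup-index c∈P⁰′))
             (CodeMult.mult-suc⇒∈ _ (PiList q) (columnParts-once a b c′ d j)))

-- (3) Quadruples with the same ψ lie in the same H-orbit of ([q]^n)^4: first
-- permute coordinates so that corresponding columns have the same partition,
-- then permute the letters in each coordinate to match the columns.
same-psi⇒H-related :
  ∀ {q n} (α β γ δ α′ β′ γ′ δ′ : Word q n) → psi α β γ δ ≡ psi α′ β′ γ′ δ′ →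
  Σ (H q n) λ h → map (act h) (α ∷ β ∷ γ ∷ δ ∷ []) ≡ α′ ∷ β′ ∷ γ′ ∷ δ′ ∷ []
same-psi⇒H-related {q} {n} α β γ δ α′ β′ γ′ δ′ ψ≡ψ′ =
  (π , σ) , cong₂ _∷_ (row α α′ (# 0) (λ _ → refl) (λ _ → refl))
           (cong₂ _∷_ (row β β′ (# 1) (λ _ → refl) (λ _ → refl))
           (cong₂ _∷_ (row γ γ′ (# 2) (λ _ → refl) (λ _ → refl))
           (cong (_∷ []) (row δ δ′ (# 3) (λ _ → refl) (λ _ → refl)))))
  where
  col = column α β γ δ
  col′ = column α′ β′ γ′ δ′
  coordinate-perm = CodeMult.same-multiplicities⇒permutation (columnParts α β γ δ) (columnParts α′ β′ γ′ δ′)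
                      (same-psi⇒same-column-multiplicities α β γ δ α′ β′ γ′ δ′ ψ≡ψ′)
  π = proj₁ coordinate-perm
  same-part : ∀ j → part (col′ j) ≡ part (col (π ⟨$⟩ʳ j))
  same-part j = begin
    part (col′ j)                                ≡⟨ sym (VecP.lookup∘tabulate (part ∘ col′) j) ⟩
    lookup (columnParts α′ β′ γ′ δ′) j           ≡⟨ proj₂ coordinate-perm j ⟩
    lookup (columnParts α β γ δ) (π ⟨$⟩ʳ j)      ≡⟨ VecP.lookup∘tabulate (part ∘ col) (π ⟨$⟩ʳ j) ⟩
    part (col (π ⟨$⟩ʳ j))                        ∎
    where open ≡-Reasoning
  letter-perm : ∀ j → Σ (Permutation′ q) λ s → ∀ i → s ⟨$⟩ʳ lookup (col (π ⟨$⟩ʳ j)) i ≡ lookup (col′ j) i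
  letter-perm j = same-pattern⇒letter-permutation (col (π ⟨$⟩ʳ j)) (col′ j)
    (same-part⇒same-pattern (col (π ⟨$⟩ʳ j)) (col′ j) (sym (same-part j)))
    (same-part⇒same-pattern (col′ j) (col (π ⟨$⟩ʳ j)) (same-part j))
  σ : Fin n → Permutation′ q
  σ j = proj₁ (letter-perm j)
  row : ∀ (a a′ : Word q n) r → (∀ j → lookup (col j) r ≡ lookup a j) → (∀ j → lookup (col′ j) r ≡ lookup a′ j) →
        act (π , σ) a ≡ a′
  row a a′ r a-row a′-row = trans
    (VecP.tabulate-cong λ j → trans (cong (σ j ⟨$⟩ʳ_) (sym (a-row (π ⟨$⟩ʳ j))))
                                    (trans (proj₂ (letter-perm j) r) (a′-row j)))
    (VecP.tabulate∘lookup a′)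

SameOrbit⇔OmegaOfIs-psi : ∀ {q n} (S : List (Word q n)) (α β γ δ : Word q n) →
                          SameOrbit (α ∷ β ∷ γ ∷ δ ∷ []) S ⇔ OmegaOfIs (psi α β γ δ) S
SameOrbit⇔OmegaOfIs-psi S α β γ δ = mk⇔
  (λ in-ω → α , β , γ , δ , refl , in-ω)
  (λ { (α′ , β′ , γ′ , δ′ , ψ′≡ψ , in-ω′) →
         let (h , h-maps) = same-psi⇒H-related α β γ δ α′ β′ γ′ δ′ (sym ψ′≡ψ)
         in SameOrbit-transport h h-maps in-ω′ })

mainTheorem4 : (n q : ℕ) → 2 ≤ q →
    (S : List (Word q n)) → length S ≤ 4 →
    (decL : (A : List (Word q n)) → Dec (SameOrbit A S)) →
    (decΩ : (μ : Monomial) → Dec (OmegaOfIs μ S)) →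
    (α β γ δ : Word q n) →
    LEntry S decL α β γ δ ≡ SumKEntry S decΩ α β γ δ
mainTheorem4 n q _ S _ decL decΩ α β γ δ = begin
  LEntry S decL α β γ δ
    ≡⟨ cong (λ b → if b then 1 else 0)
            (does-⇔ (SameOrbit⇔OmegaOfIs-psi S α β γ δ) (decL (α ∷ β ∷ γ ∷ δ ∷ [])) (decΩ (psi α β γ δ))) ⟩
  (if does (decΩ (psi α β γ δ)) then 1 else 0)
    ≡⟨ sym (SumKEntry-indicator S decΩ α β γ δ) ⟩
  SumKEntry S decΩ α β γ δ ∎
  where open ≡-Reasoning
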